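{- Let $G$ be a finite graph and $\mathcal L$ a non-trivial linear class of bonds of $G$. Then the bases of the complete join matroid $J_0(G,\mathcal L)$ are exactly: (1) the edge sets of maximal forests of $G$, and (2) the sets $F\cup\{e_0\}$ where $F$ is obtained from a maximal forest of $G$ by deleting one edge and the bond $\mathrm{Ext}(\pi_F)$ is not in $\mathcal L$.
   Context: Graphs are finite, loops and multiple edges allowed. A bond is a minimal nonempty edge cut; $\delta(X)$ is the set of links with exactly one endpoint in $X\subseteq V(G)$. A tribond is $\delta(X_1)\cup\delta(X_2)\cup\delta(X_3)$ for a partition $\{X_1,X_2,X_3\}$ of the vertex set of one connected component into nonempty sets with each $G[X_i]$ connected and an edge joining each pair. A linear class of bonds is a set $\mathcal L$ of bonds such that for each such tripartition the number of $i$ with $\delta(X_i)\in\mathcal L$ is never exactly two; it is trivial if it contains every bond. A modular pair of bonds $B_1,B_2$ is one for which $G-(B_1\cup B_2)$ has two more components than $G$; a dibond is the union of a modular pair that is not a tribond. For non-trivial $\mathcal L$, $J_0(G,\mathcal L)$ is the matroid on $E(G)\cup\{e_0\}$ whose cocircuits are the bonds in $\mathcal L$, the sets $B\cup\{e_0\}$ for bonds $B\notin\mathcal L$, and the tribonds and dibonds containing no bond of $\mathcal L$; it is a single-element extension of the cycle matroid $M(G)$. For $F\subseteq E(G)$, $\pi_F$ is the partition of $V(G)$ into the vertex sets of the connected components of the spanning subgraph $(V(G),F)$, and for a partition $\pi$ of $V(G)$, $\mathrm{Ext}(\pi)$ is the set of edges of $G$ whose endpoints lie in different parts of $\pi$.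 (When $F$ is a maximal forest minus one edge, $\mathrm{Ext}(\pi_F)$ is a bond.) -}

module Defs where

open import Data.Nat using (ℕ; suc; _+_)
open import Data.Fin using (Fin)
open import Data.Bool using (Bool; true; false; _xor_)
open import Data.Product using (Σ; ∃; _×_; _,_; proj₁; proj₂)
open import Data.Sum using (_⊎_)
open import Data.Vec using (_∷_; tabulate; lookup)
open import Data.Fin.Subset using (Subset; inside; outside; _∈_; _∉_; _⊆_; _∪_; _∩_; _-_; ∁; Nonempty; Empty)
open import Relation.Binary.PropositionalEquality using (_≡_; _≢_)
open import Relation.Nullary using (¬_)
open import Function.Bundles using (_⇔_)
import Data.Empty as E
import Data.Unit as U

-- A finite graph with vertex set Fin n and edge set Fin m; each edge has an
-- (ordered, but only used unordered) pair of ends.  Loops (equal ends) and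
-- parallel edges are allowed.
Graph : ℕ → ℕ → Set
Graph n m = Fin m → Fin n × Fin n

b2n : Bool → ℕ
b2n true  = 1
b2n false = 0

-- A set is independent in the dual iff it contains no cocircuit; the bases
-- are the complements of the maximal dual-independent sets (cobases).

CoIndep : ∀ {k} → (Subset k → Set) → Subset k → Set
CoIndep Cocirc I = ∀ C → Cocirc C → C ⊆ I → E.⊥

IsBasis : ∀ {k} → (Subset k → Set) → Subset k → Set
IsBasis Cocirc B =
  CoIndep Cocirc (∁ B) × (∀ I → CoIndep Cocirc I → ∁ B ⊆ I → I ⊆ ∁ B)

module _ {n m : ℕ} (G : Graph n m) where

  src tgt : Fin m → Fin n
  src e = proj₁ (G e)
  tgt e = proj₂ (G e)

  data Reach (P : Fin m → Set) (u : Fin n) : Fin n → Set where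
    here : Reach P u u
    step : ∀ {v w} (e : Fin m) → Reach P u v → P e →
           (src e ≡ v × tgt e ≡ w) ⊎ (src e ≡ w × tgt e ≡ v) → Reach P u w

  AllEdges : Fin m → Set
  AllEdges _ = U.⊤

  InSet : Subset m → Fin m → Set
  InSet F e = e ∈ F

  Induced : Subset n → Fin m → Set
  Induced X e = src e ∈ X × tgt e ∈ X

  δ : Subset n → Subset m
  δ X = tabulate (λ e → lookup X (src e) xor lookup X (tgt e))

  IsCut : Subset m → Set
  IsCut S = ∃ λ X → S ≡ δ X

  IsBond : Subset m → Set
  IsBond S = IsCut S × Nonempty S ×
             (∀ S' → IsCut S' → Nonempty S' → S' ⊆ S → S' ≡ S)

  IsComponent : Subset n → Set
  IsComponent C = ∃ λ v → ∀ u → (u ∈ C ⇔ Reach AllEdges v u)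

  InducedConnected : Subset n → Set
  InducedConnected X = ∀ u v → u ∈ X → v ∈ X → Reach (Induced X) u v

  Joined : Subset n → Subset n → Set
  Joined X Y = ∃ λ e → (src e ∈ X × tgt e ∈ Y) ⊎ (src e ∈ Y × tgt e ∈ X)

  Tripartition : Subset n → Subset n → Subset n → Set
  Tripartition X₁ X₂ X₃ =
    IsComponent (X₁ ∪ X₂ ∪ X₃) ×
    (Empty (X₁ ∩ X₂) × Empty (X₁ ∩ X₃) × Empty (X₂ ∩ X₃)) ×
    (Nonempty X₁ × Nonempty X₂ × Nonempty X₃) ×
    (InducedConnected X₁ × InducedConnected X₂ × InducedConnected X₃) ×
    (Joined X₁ X₂ × Joined X₁ X₃ × Joined X₂ X₃)

  IsTribond : Subset m → Set
  IsTribond T = ∃ λ X₁ → ∃ λ X₂ → ∃ λ X₃ →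
    Tripartition X₁ X₂ X₃ × T ≡ δ X₁ ∪ δ X₂ ∪ δ X₃

  NumComp : (Fin m → Set) → ℕ → Set
  NumComp P k = Σ (Fin n → Fin k) λ c →
    (∀ j → ∃ λ v → c v ≡ j) × (∀ u v → (c u ≡ c v ⇔ Reach P u v))

  ModularPair : Subset m → Subset m → Set
  ModularPair B₁ B₂ = IsBond B₁ × IsBond B₂ ×
    ∃ λ k → NumComp AllEdges k × NumComp (λ e → e ∉ B₁ ∪ B₂) (2 + k)

  IsDibond : Subset m → Set
  IsDibond D = ∃ λ B₁ → ∃ λ B₂ →
    ModularPair B₁ B₂ × D ≡ B₁ ∪ B₂ × ¬ IsTribond D

  -- a class of bonds is given by its (decidable) membership function
  LinearClass : (Subset m → Bool) → Set
  LinearClass L = (∀ S → L S ≡ true → IsBond S) ×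
    (∀ X₁ X₂ X₃ → Tripartition X₁ X₂ X₃ →
       b2n (L (δ X₁)) + b2n (L (δ X₂)) + b2n (L (δ X₃)) ≢ 2)

  NonTrivial : (Subset m → Bool) → Set
  NonTrivial L = ∃ λ B → IsBond B × L B ≡ false

  ContainsNoLBond : (Subset m → Bool) → Subset m → Set
  ContainsNoLBond L T = ∀ B → L B ≡ true → B ⊆ T → E.⊥

  -- Cocircuits of J0(G,L) on ground set Fin (suc m): index 0 is e0 and
  -- index (suc e) is the edge e of G, so  b ∷ S  is S plus e0 iff b = inside.
  data J0Cocircuit (L : Subset m → Bool) : Subset (suc m) → Set where
    lbond  : ∀ B → IsBond B → L B ≡ true  → J0Cocircuit L (outside ∷ B)
    nlbond : ∀ B → IsBond B → L B ≡ false → J0Cocircuit L (inside ∷ B)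
    tri    : ∀ T → IsTribond T → ContainsNoLBond L T → J0Cocircuit L (outside ∷ T)
    di     : ∀ D → IsDibond D → ContainsNoLBond L D → J0Cocircuit L (outside ∷ D)

  -- forest: no edge of F lies on a cycle of F, i.e. deleting any edge of F
  -- leaves its ends disconnected in F (this also excludes loops)
  IsForest : Subset m → Set
  IsForest F = ∀ e → e ∈ F → ¬ Reach (InSet (F - e)) (src e) (tgt e)

  IsMaxForest : Subset m → Set
  IsMaxForest F = IsForest F × (∀ F' → IsForest F' → F ⊆ F' → F' ⊆ F)

  -- π_F : parts are vertex sets of components of (V(G), F);
  -- Ext(π_F) : edges whose ends lie in different parts.
  SamePart : Subset m → Fin n → Fin n → Set
  SamePart F u v = Reach (InSet F) u v

  InExt : Subset m → Fin m → Set
  InExt F e = ¬ SamePart F (src e) (tgt e)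

module Submission where

-- Every
-- cocircuit is a nonempty union of cuts, so it meets every spanning edge set; and if the ends of
-- an edge x are not connected in H, there is a bond through x avoiding H. Hence the bases
-- without e₀ are the spanning forests. For a basis e₀ ∷ F the complement of F must contain no
-- modular pair of bonds; but whenever edges e and then f can be added to F without closing a
-- cycle, two nested separations give bonds B₁ ∋ e and B₂ ∋ f avoiding F whose removal splits
-- off exactly two new components. So F is a maximal forest T minus an edge e. Conversely, for
-- such F every component of G falls into at most two F-classes, separated by the fundamental cut
-- S = Ext(π_F): this makes S the only bond avoiding F and rules out tribonds and dibonds avoiding
-- F, while L S ≡ false keeps S from being a cocircuit there.

open import Defs
open import Data.Nat using (ℕ; zero; suc; _+_; _≤_)
open import Data.Nat.Properties using (≤⇒≯; n<1+n)
open import Data.Fin using (Fin; punchOut; punchIn) renaming (zero to fzero; suc to fsuc)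
open import Data.Fin.Properties
  using ( ¬Fin0; ¬∀⟶∃¬; suc-injective; injective⇒≤
        ; punchOut-cong; punchOut-injective; punchOut-punchIn; punchInᵢ≢i )
  renaming (_≟_ to _≟ᶠ_)
open import Data.Bool using (Bool; true; false; not; _xor_)
open import Data.Bool.Properties using (¬-not) renaming (_≟_ to _≟ᵇ_)
open import Data.Product using (∃; ∃₂; _×_; _,_; proj₁; proj₂)
open import Data.Sum using (_⊎_; inj₁; inj₂; [_,_])
open import Data.Empty using (⊥; ⊥-elim)
open import Data.Unit using (tt)
open import Data.Vec using (_∷_; here; there; tabulate; lookup)
open import Data.Vec.Properties using (lookup∘tabulate; []=⇒lookup; lookup⇒[]=)
open import Data.Fin.Subset
  using (Subset; inside; outside; _∈_; _∉_; _⊆_; _∪_; _∩_; _─_; _-_; ∁; ⁅_⁆; Nonempty; Empty)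
open import Data.Fin.Subset.Properties
  using ( ⊆-antisym; _∈?_; out⊆; s⊆s; drop-∷-⊆; drop-there; x∈p∪q⁻; x∈p∪q⁺; x∈p∩q⁺; x∈∁p⇒x∉p; x∉p⇒x∈∁p
        ; p⊆p∪q; q⊆p∪q; x∈⁅x⁆; x∈⁅y⁆⇒x≡y; p─q⊆p; x∈p∧x≢y⇒x∈p-y )
open import Data.List using (List; []; _∷_; allFin)
open import Data.List.Membership.Propositional using () renaming (_∈_ to _∈ₗ_)
open import Data.List.Membership.Propositional.Properties using (∈-allFin)
open import Data.List.Relation.Unary.Any using () renaming (here to hereₗ; there to thereₗ)
open import Function using (_∘_; id)
open import Function.Bundles using (_⇔_; mk⇔; Equivalence)
open import Relation.Binary.PropositionalEquality
  using (_≡_; _≢_; refl; sym; trans; cong; cong₂; subst; module ≡-Reasoning)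
open import Relation.Nullary using (¬_; Dec; yes; no; does; contradiction)
open import Relation.Nullary.Decidable using (dec-true; dec-false; ¬?; _×-dec_; _⊎-dec_; decidable-stable)
open import Relation.Unary using (Decidable)

open Equivalence using (to; from)

xor≡true⇒≢ : ∀ {a b} → a xor b ≡ true → a ≢ b
xor≡true⇒≢ {true} {true} () refl
xor≡true⇒≢ {false} {false} () refl

≢⇒xor≡true : ∀ {a b} → a ≢ b → a xor b ≡ true
≢⇒xor≡true {true} {true} a≢b = contradiction refl a≢b
≢⇒xor≡true {true} {false} _ = refl
≢⇒xor≡true {false} {true} _ = refl
≢⇒xor≡true {false} {false} a≢b = contradiction refl a≢b

three-distinct-bools : ∀ {a b c : Bool} → a ≢ b → a ≢ c → b ≢ c → ⊥
three-distinct-bools {true} {true} a≢b _ _ = a≢b refl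
three-distinct-bools {false} {false} a≢b _ _ = a≢b refl
three-distinct-bools {true} {false} {true} _ a≢c _ = a≢c refl
three-distinct-bools {true} {false} {false} _ _ b≢c = b≢c refl
three-distinct-bools {false} {true} {true} _ _ b≢c = b≢c refl
three-distinct-bools {false} {true} {false} _ a≢c _ = a≢c refl

true-iff⇒≡ : ∀ {a b} → (a ≡ true → b ≡ true) → (b ≡ true → a ≡ true) → a ≡ b
true-iff⇒≡ {true} a⇒b _ = sym (a⇒b refl)
true-iff⇒≡ {false} {true} _ b⇒a = b⇒a refl
true-iff⇒≡ {false} {false} _ _ = refl

x∈p─q⇒x∉q : ∀ {k} {p q : Subset k} {x} → x ∈ p ─ q → x ∉ q
x∈p─q⇒x∉q {p = _ ∷ _} {outside ∷ _} {fzero} here ()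
x∈p─q⇒x∉q {p = _ ∷ _} {_ ∷ _} {fsuc _} (there x∈) (there x∈q) = x∈p─q⇒x∉q x∈ x∈q

x∈p-y⇒x≢y : ∀ {k} {p : Subset k} {x y} → x ∈ p - y → x ≢ y
x∈p-y⇒x≢y x∈ refl = x∈p─q⇒x∉q x∈ (x∈⁅x⁆ _)

∷-⊆-∷ : ∀ {k b c} {p q r : Subset k} → b ∷ p ⊆ c ∷ q → p ⊆ r → b ∷ p ⊆ c ∷ r
∷-⊆-∷ b∷p⊆ _ here with b∷p⊆ here
... | here = here
∷-⊆-∷ _ p⊆r (there x∈) = there (p⊆r x∈)

-- Relabelling components

module Merge {k : ℕ} {a b : Fin (suc k)} (a≢b : a ≢ b) where

  private
    redirect : Fin (suc k) → Fin (suc k)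
    redirect j with j ≟ᶠ b
    ... | yes _ = a
    ... | no _ = j

    redirect≢b : ∀ j → redirect j ≢ b
    redirect≢b j with j ≟ᶠ b
    ... | yes _ = a≢b
    ... | no j≢b = j≢b

  merge : Fin (suc k) → Fin k
  merge j = punchOut (redirect≢b j ∘ sym)

  merge-identifies : merge a ≡ merge b
  merge-identifies = punchOut-cong b (redirect-a-b)
    where
      redirect-a-b : redirect a ≡ redirect b
      redirect-a-b with a ≟ᶠ b | b ≟ᶠ b
      ... | yes a≡b | _ = contradiction a≡b a≢b
      ... | no _ | yes _ = refl
      ... | no _ | no b≢b = contradiction refl b≢b

  merge-surjective : ∀ i → ∃ λ j → merge j ≡ i
  merge-surjective i = punchIn b i , trans (punchOut-cong b fixed) (punchOut-punchIn b)
    where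
      fixed : redirect (punchIn b i) ≡ punchIn b i
      fixed with punchIn b i ≟ᶠ b
      ... | yes p = contradiction p (punchInᵢ≢i b i)
      ... | no _ = refl

  merge-fibres : ∀ {i j} → merge i ≡ merge j → i ≡ j ⊎ (i ≡ a × j ≡ b) ⊎ (i ≡ b × j ≡ a)
  merge-fibres {i} {j} eq
    with punchOut-injective (redirect≢b i ∘ sym) (redirect≢b j ∘ sym) eq
  ... | same with i ≟ᶠ b | j ≟ᶠ b
  ... | yes i≡b | yes j≡b = inj₁ (trans i≡b (sym j≡b))
  ... | yes i≡b | no _ = inj₂ (inj₂ (i≡b , sym same))
  ... | no _ | yes j≡b = inj₂ (inj₁ (same , j≡b))
  ... | no _ | no _ = inj₁ same

module _ {n m : ℕ} (G : Graph n m) where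

  private
    variable
      P Q : Fin m → Set
      W : Fin n → Set
      u v w : Fin n
      x e : Fin m
      k j : ℕ

  -- Walks

  Joins : Fin m → Fin n → Fin n → Set
  Joins x u v = (src G x ≡ u × tgt G x ≡ v) ⊎ (src G x ≡ v × tgt G x ≡ u)

  joins-ends : ∀ x → Joins x (src G x) (tgt G x)
  joins-ends x = inj₁ (refl , refl)

  joins-sym : Joins x u v → Joins x v u
  joins-sym (inj₁ (p , q)) = inj₂ (p , q)
  joins-sym (inj₂ (p , q)) = inj₁ (p , q)

  joins-invariant : ∀ {A : Set} (f : Fin n → A) →
    f (src G x) ≡ f (tgt G x) → Joins x u v → f u ≡ f v
  joins-invariant f eq (inj₁ (refl , refl)) = eq
  joins-invariant f eq (inj₂ (refl , refl)) = sym eq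

  joins-invariant⁻¹ : ∀ {A : Set} (f : Fin n → A) → Joins x u v → f u ≡ f v → f (src G x) ≡ f (tgt G x)
  joins-invariant⁻¹ f (inj₁ (refl , refl)) eq = eq
  joins-invariant⁻¹ f (inj₂ (refl , refl)) eq = sym eq

  joins-within : W u → W v → Joins x u v → W (src G x) × W (tgt G x)
  joins-within wu wv (inj₁ (refl , refl)) = wu , wv
  joins-within wu wv (inj₂ (refl , refl)) = wv , wu

  reach-edge : P x → Joins x u v → Reach G P u v
  reach-edge px j = step _ here px j

  reach-map : (∀ {x} → P x → Q x) → Reach G P u v → Reach G Q u v
  reach-map f here = here
  reach-map f (step x r px j) = step x (reach-map f r) (f px) j

  reach-trans : Reach G P u v → Reach G P v w → Reach G P u w
  reach-trans r here = r
  reach-trans r (step x r′ px j) = step x (reach-trans r r′) px j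

  reach-sym : Reach G P u v → Reach G P v u
  reach-sym here = here
  reach-sym (step x r px j) = reach-trans (reach-edge px (joins-sym j)) (reach-sym r)

  joins-reach : ∀ {a b c d} → Joins x a b → Joins x c d → Reach G P a b → Reach G P c d
  joins-reach (inj₁ (refl , refl)) (inj₁ (refl , refl)) r = r
  joins-reach (inj₁ (refl , refl)) (inj₂ (refl , refl)) r = reach-sym r
  joins-reach (inj₂ (refl , refl)) (inj₁ (refl , refl)) r = reach-sym r
  joins-reach (inj₂ (refl , refl)) (inj₂ (refl , refl)) r = r

  reach-invariant : ∀ {A : Set} (f : Fin n → A) →
    (∀ {x} → P x → f (src G x) ≡ f (tgt G x)) → Reach G P u v → f u ≡ f v
  reach-invariant f inv here = refl
  reach-invariant f inv (step x r px j) =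
    trans (reach-invariant f inv r) (joins-invariant f (inv px) j)

  reach-crossing : (f : Fin n → Bool) → Reach G P u v → f u ≢ f v →
    ∃ λ x → P x × f (src G x) ≢ f (tgt G x)
  reach-crossing f here fu≢fv = contradiction refl fu≢fv
  reach-crossing {u = u} f (step {v = v} x r px j) fu≢fw with f u ≟ᵇ f v
  ... | yes fu≡fv = x , px , λ eq → fu≢fw (trans fu≡fv (joins-invariant f eq j))
  ... | no fu≢fv = reach-crossing f r fu≢fv

  Within : (Fin n → Set) → (Fin m → Set) → Fin m → Set
  Within W P x = P x × W (src G x) × W (tgt G x)

  reach-within : (∀ {w} → Reach G P u w → W w) → Reach G P u v → Reach G (Within W P) u v
  reach-within stays here = here
  reach-within stays (step x r px j) =
    step x (reach-within stays r) (px , joins-within (stays r) (stays (step x r px j)) j) j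

  reach-within-end : Reach G (Within W P) u v → W u → W v
  reach-within-end here wu = wu
  reach-within-end (step x r (_ , ws , wt) (inj₁ (refl , refl))) _ = wt
  reach-within-end (step x r (_ , ws , wt) (inj₂ (refl , refl))) _ = ws

  reach-exit : Decidable W → Reach G P u v → W u → ¬ W v →
    ∃₂ λ a b → ∃ λ x → P x × Joins x a b × W a × ¬ W b × Reach G (Within W P) u a
  reach-exit {W = W} {P = P} {u = u} W? r wu ¬wv with stays-or-exits r
    where
      Exit : Set
      Exit = ∃₂ λ a b → ∃ λ x → P x × Joins x a b × W a × ¬ W b × Reach G (Within W P) u a
      stays-or-exits : Reach G P u w → Reach G (Within W P) u w ⊎ Exit
      stays-or-exits here = inj₁ here
      stays-or-exits (step {w = w} x r px j) with stays-or-exits r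
      ... | inj₂ exit = inj₂ exit
      ... | inj₁ r′ with W? w
      ...   | yes ww = inj₁ (step x r′ (px , joins-within (reach-within-end r′ wu) ww j) j)
      ...   | no ¬ww = inj₂ (_ , w , x , px , j , reach-within-end r′ wu , ¬ww , r′)
  ... | inj₁ r′ = contradiction (reach-within-end r′ wu) ¬wv
  ... | inj₂ exit = exit

  reach-addEdge : (∀ {x} → Q x → P x ⊎ x ≡ e) → Reach G Q u v →
    Reach G P u v ⊎ (∃₂ λ a b → Joins e a b × Reach G P u a × Reach G P b v)
  reach-addEdge split here = inj₁ here
  reach-addEdge split (step x r qx j) with reach-addEdge split r | split qx
  ... | inj₁ r′ | inj₁ px = inj₁ (step x r′ px j)
  ... | inj₂ (a , b , je , ra , rb) | inj₁ px = inj₂ (a , b , je , ra , step x rb px j)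
  ... | inj₁ r′ | inj₂ refl = inj₂ (_ , _ , j , r′ , here)
  ... | inj₂ (a , b , je , ra , rb) | inj₂ refl = through je j ra rb
    where
      through : ∀ {a b c d} → Joins x a b → Joins x c d → Reach G P u a → Reach G P b c →
        Reach G P u d ⊎ (∃₂ λ a b → Joins x a b × Reach G P u a × Reach G P b d)
      through je@(inj₁ (refl , refl)) (inj₁ (refl , refl)) ra rb = inj₂ (_ , _ , je , ra , here)
      through (inj₁ (refl , refl)) (inj₂ (refl , refl)) ra rb = inj₁ ra
      through (inj₂ (refl , refl)) (inj₁ (refl , refl)) ra rb = inj₁ ra
      through je@(inj₂ (refl , refl)) (inj₂ (refl , refl)) ra rb = inj₂ (_ , _ , je , ra , here)

  reach-addEdge-from : (∀ {x} → Q x → P x ⊎ x ≡ e) → Reach G Q u v →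
    Reach G P u v ⊎ Reach G P (src G e) v ⊎ Reach G P (tgt G e) v
  reach-addEdge-from split r with reach-addEdge split r
  ... | inj₁ r′ = inj₁ r′
  ... | inj₂ (_ , _ , inj₁ (_ , refl) , _ , rb) = inj₂ (inj₂ rb)
  ... | inj₂ (_ , _ , inj₂ (refl , _) , _ , rb) = inj₂ (inj₁ rb)

  -- Counting components

  numComp-cong : (∀ {x} → P x → Q x) → (∀ {x} → Q x → P x) → NumComp G P k → NumComp G Q k
  numComp-cong P⇒Q Q⇒P (c , surj , same) =
    c , surj , λ u v → mk⇔ (reach-map P⇒Q ∘ to (same u v)) (from (same u v) ∘ reach-map Q⇒P)

  numComp-addEdge : NumComp G Q k → ∃ λ k′ → NumComp G (λ x → x ≡ e ⊎ Q x) k′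
  numComp-addEdge {Q = Q} {k = k} {e = e} (c , surj , same)
    with c (src G e) ≟ᶠ c (tgt G e)
  ... | yes c-e = k , c , surj , λ u v →
      mk⇔ (reach-map inj₂ ∘ to (same u v)) (reach-invariant c c-edge)
    where
      c-edge : ∀ {x} → x ≡ e ⊎ Q x → c (src G x) ≡ c (tgt G x)
      c-edge (inj₁ refl) = c-e
      c-edge (inj₂ qx) = from (same _ _) (reach-edge qx (joins-ends _))
  numComp-addEdge {k = zero} {e = e} (c , _) | no _ = ⊥-elim (¬Fin0 (c (src G e)))
  numComp-addEdge {Q = Q} {k = suc k} {e = e} (c , surj , same) | no c-e =
    k , merge ∘ c , surj′ , λ u v → mk⇔ (connect u v) (reach-invariant (merge ∘ c) merged)
    where
      open Merge c-e
      Q+e : Fin m → Set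
      Q+e x = x ≡ e ⊎ Q x
      lift : Reach G Q u v → Reach G Q+e u v
      lift = reach-map inj₂
      edge-e : Reach G Q+e (src G e) (tgt G e)
      edge-e = reach-edge (inj₁ refl) (joins-ends e)
      surj′ : ∀ i → ∃ λ v → merge (c v) ≡ i
      surj′ i with merge-surjective i
      ... | j , mj≡i with surj j
      ...   | v , cv≡j = v , trans (cong merge cv≡j) mj≡i
      connect : ∀ u v → merge (c u) ≡ merge (c v) → Reach G Q+e u v
      connect u v eq with merge-fibres eq
      ... | inj₁ cu≡cv = lift (to (same u v) cu≡cv)
      ... | inj₂ (inj₁ (cu≡ , cv≡)) =
        reach-trans (lift (to (same _ _) cu≡)) (reach-trans edge-e (lift (to (same _ _) (sym cv≡))))
      ... | inj₂ (inj₂ (cu≡ , cv≡)) =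
        reach-trans (lift (to (same _ _) cu≡))
          (reach-trans (reach-sym edge-e) (lift (to (same _ _) (sym cv≡))))
      merged : ∀ {x} → Q+e x → merge (c (src G x)) ≡ merge (c (tgt G x))
      merged (inj₁ refl) = merge-identifies
      merged (inj₂ qx) = cong merge (from (same _ _) (reach-edge qx (joins-ends _)))

  opaque
    numComp : Decidable P → ∃ λ k → NumComp G P k
    numComp {P = P} P? with restricted (allFin m)
      where
        restricted : (es : List (Fin m)) → ∃ λ k → NumComp G (λ x → x ∈ₗ es × P x) k
        restricted [] = n , id , (λ v → v , refl) ,
          λ u v → mk⇔ (λ { refl → here }) (reach-invariant id (λ { (() , _) }))
        restricted (e ∷ es) with restricted es | P? e
        ... | k , comps | no ¬pe = k , numComp-cong (λ (i , px) → thereₗ i , px) drop comps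
          where
            drop : ∀ {x} → x ∈ₗ e ∷ es × P x → x ∈ₗ es × P x
            drop (hereₗ refl , px) = contradiction px ¬pe
            drop (thereₗ i , px) = i , px
        ... | k , comps | yes pe with numComp-addEdge {e = e} comps
        ...   | k′ , comps′ = k′ , numComp-cong add split comps′
          where
            add : ∀ {x} → x ≡ e ⊎ (x ∈ₗ es × P x) → x ∈ₗ e ∷ es × P x
            add (inj₁ refl) = hereₗ refl , pe
            add (inj₂ (i , px)) = thereₗ i , px
            split : ∀ {x} → x ∈ₗ e ∷ es × P x → x ≡ e ⊎ (x ∈ₗ es × P x)
            split (hereₗ refl , _) = inj₁ refl
            split (thereₗ i , px) = inj₂ (i , px)
    ... | k , comps = k , numComp-cong proj₂ (λ px → ∈-allFin _ , px) comps

    reach? : Decidable P → ∀ u v → Dec (Reach G P u v)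
    reach? P? u v with numComp P?
    ... | _ , c , _ , same with c u ≟ᶠ c v
    ...   | yes cu≡cv = yes (to (same u v) cu≡cv)
    ...   | no cu≢cv = no (cu≢cv ∘ from (same u v))

  all? : Decidable (AllEdges G)
  all? _ = yes tt

  numComp-bound : NumComp G P k → (r : Fin j → Fin n) → (∀ v → ∃ λ i → Reach G P (r i) v) → k ≤ j
  numComp-bound {k = k} {j = j} (c , surj , same) r covered = injective⇒≤ {f = pick} pick-injective
    where
      pick : Fin k → Fin j
      pick ℓ = proj₁ (covered (proj₁ (surj ℓ)))
      label : ∀ ℓ → c (r (pick ℓ)) ≡ ℓ
      label ℓ = trans (from (same _ _) (proj₂ (covered _))) (proj₂ (surj ℓ))
      pick-injective : ∀ {ℓ ℓ′} → pick ℓ ≡ pick ℓ′ → ℓ ≡ ℓ′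
      pick-injective {ℓ} {ℓ′} eq = trans (sym (label ℓ)) (trans (cong (c ∘ r) eq) (label ℓ′))

  -- Cuts and bonds

  lookup-δ : ∀ X x → lookup (δ G X) x ≡ lookup X (src G x) xor lookup X (tgt G x)
  lookup-δ X = lookup∘tabulate _

  ∈δ⇒≢ : ∀ X → x ∈ δ G X → lookup X (src G x) ≢ lookup X (tgt G x)
  ∈δ⇒≢ {x} X x∈ = xor≡true⇒≢ (trans (sym (lookup-δ X x)) ([]=⇒lookup x∈))

  ≢⇒∈δ : ∀ X → lookup X (src G x) ≢ lookup X (tgt G x) → x ∈ δ G X
  ≢⇒∈δ {x = x} X ne = lookup⇒[]= x (δ G X) (trans (lookup-δ X x) (≢⇒xor≡true ne))

  ≡⇒∉δ : ∀ X → lookup X (src G x) ≡ lookup X (tgt G x) → x ∉ δ G X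
  ≡⇒∉δ X eq x∈ = ∈δ⇒≢ X x∈ eq

  ∉δ⇒≡ : ∀ X → x ∉ δ G X → lookup X (src G x) ≡ lookup X (tgt G x)
  ∉δ⇒≡ X x∉ = decidable-stable (_ ≟ᵇ _) (x∉ ∘ ≢⇒∈δ X)

  ∈δ-orient : ∀ X → x ∈ δ G X → ∃₂ λ a b → Joins x a b × lookup X a ≡ true × lookup X b ≡ false
  ∈δ-orient {x} X x∈ with lookup X (src G x) in eqₛ | lookup X (tgt G x) in eqₜ
  ... | true | true = contradiction (trans eqₛ (sym eqₜ)) (∈δ⇒≢ X x∈)
  ... | true | false = _ , _ , joins-ends x , eqₛ , eqₜ
  ... | false | true = _ , _ , joins-sym (joins-ends x) , eqₜ , eqₛ
  ... | false | false = contradiction (trans eqₛ (sym eqₜ)) (∈δ⇒≢ X x∈)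

  joins-∈δ : ∀ X → Joins x u v → lookup X u ≡ false → lookup X v ≡ true → x ∈ δ G X
  joins-∈δ X j xu xv = ≢⇒∈δ X λ eq →
    contradiction (trans (sym xu) (trans (joins-invariant (lookup X) eq j) xv)) λ ()

  reach-side : ∀ X → (∀ {x} → P x → x ∉ δ G X) → Reach G P u v → lookup X u ≡ lookup X v
  reach-side X avoids = reach-invariant (lookup X) (∉δ⇒≡ X ∘ avoids)

  reach-meets-cut : ∀ X → Reach G P u v → lookup X u ≢ lookup X v → ∃ λ y → P y × y ∈ δ G X
  reach-meets-cut X r ne with reach-crossing (lookup X) r ne
  ... | y , py , crosses = y , py , ≢⇒∈δ X crosses

  _∖δ_ : (Fin m → Set) → Subset n → Fin m → Set
  (P ∖δ Y) x = P x × x ∉ δ G Y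

  within-side : ∀ Y {β} → Within (λ w → lookup Y w ≡ β) P x → (P ∖δ Y) x
  within-side Y (px , ys , yt) = px , ≡⇒∉δ Y (trans ys (sym yt))

  reach-∈ : ∀ X → (∀ {y} → P y → y ∉ δ G X) → Reach G P u v → u ∈ X → v ∈ X
  reach-∈ {v = v} X avoids r u∈ = lookup⇒[]= v X (trans (sym (reach-side X avoids r)) ([]=⇒lookup u∈))

  UnionOfCuts : Subset m → Set
  UnionOfCuts C = ∀ {x} → x ∈ C → ∃ λ X → x ∈ δ G X × δ G X ⊆ C

  cuts-meet-walks : ∀ {C} → UnionOfCuts C → x ∈ C → Reach G P (src G x) (tgt G x) → ∃ λ y → P y × y ∈ C
  cuts-meet-walks cuts x∈ r with cuts x∈
  ... | X , x∈δX , δX⊆C with reach-meets-cut X r (∈δ⇒≢ X x∈δX)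
  ...   | y , py , y∈δX = y , py , δX⊆C y∈δX

  δ-cuts : ∀ X → UnionOfCuts (δ G X)
  δ-cuts X x∈ = X , x∈ , id

  bond-cuts : ∀ {B} → IsBond G B → UnionOfCuts B
  bond-cuts ((X , refl) , _) = δ-cuts X

  ∪-cuts : ∀ {C D} → UnionOfCuts C → UnionOfCuts D → UnionOfCuts (C ∪ D)
  ∪-cuts {C} {D} cuts-C cuts-D x∈ with x∈p∪q⁻ C D x∈
  ... | inj₁ x∈C = let (X , x∈δX , δX⊆C) = cuts-C x∈C in X , x∈δX , p⊆p∪q D ∘ δX⊆C
  ... | inj₂ x∈D = let (X , x∈δX , δX⊆D) = cuts-D x∈D in X , x∈δX , q⊆p∪q C D ∘ δX⊆D

  joined-δ : ∀ {X₁ X₂} → Empty (X₁ ∩ X₂) → Joined G X₁ X₂ → Nonempty (δ G X₁)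
  joined-δ {X₁} {X₂} disjoint (x , ends) = x , ≢⇒∈δ X₁ (crosses ends)
    where
      leaves : ∀ {w w′} → w ∈ X₁ → w′ ∈ X₂ → lookup X₁ w ≢ lookup X₁ w′
      leaves {w′ = w′} w∈ w′∈ eq =
        disjoint (w′ , x∈p∩q⁺ (lookup⇒[]= w′ X₁ (trans (sym eq) ([]=⇒lookup w∈)) , w′∈))
      crosses : (src G x ∈ X₁ × tgt G x ∈ X₂) ⊎ (src G x ∈ X₂ × tgt G x ∈ X₁) →
        lookup X₁ (src G x) ≢ lookup X₁ (tgt G x)
      crosses (inj₁ (s∈ , t∈)) = leaves s∈ t∈
      crosses (inj₂ (s∈ , t∈)) = leaves t∈ s∈ ∘ sym

  record ConnectedSides (P : Fin m → Set) (Y : Subset n) : Set where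
    field
      inside-connected : ∀ {u v} → lookup Y u ≡ true → lookup Y v ≡ true → Reach G (P ∖δ Y) u v
      outside-connected : ∀ {u v} → lookup Y u ≡ false → lookup Y v ≡ false →
        Reach G P u v → Reach G (P ∖δ Y) u v

  δ-isBond : ∀ Y → x ∈ δ G Y → ConnectedSides (AllEdges G) Y → IsBond G (δ G Y)
  δ-isBond Y x∈ sides = (Y , refl) , (_ , x∈) , minimal
    where
      open ConnectedSides sides
      minimal : ∀ S → IsCut G S → Nonempty S → S ⊆ δ G Y → S ≡ δ G Y
      minimal _ (X , refl) (x₁ , x₁∈) δX⊆δY = ⊆-antisym δX⊆δY δY⊆δX
        where
          side-X : Reach G (AllEdges G ∖δ Y) u v → lookup X u ≡ lookup X v
          side-X = reach-side X λ (_ , ∉δY) ∈δX → ∉δY (δX⊆δY ∈δX)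
          δY⊆δX : δ G Y ⊆ δ G X
          δY⊆δX {x} x∈δY with ∈δ-orient Y x∈δY | ∈δ-orient Y (δX⊆δY x₁∈)
          ... | a , b , jx , ya , yb | a₁ , b₁ , jx₁ , ya₁ , yb₁ =
            ≢⇒∈δ X λ eq → ∈δ⇒≢ X x₁∈ (joins-invariant⁻¹ (lookup X) jx₁ (begin
              lookup X a₁ ≡⟨ side-X (inside-connected ya₁ ya) ⟩
              lookup X a  ≡⟨ joins-invariant (lookup X) eq jx ⟩
              lookup X b  ≡⟨ side-X (outside-connected yb yb₁ b⟶b₁) ⟩
              lookup X b₁ ∎))
            where
              open ≡-Reasoning
              b⟶b₁ : Reach G (AllEdges G) b b₁
              b⟶b₁ = reach-trans (reach-edge tt (joins-sym jx))
                (reach-trans (reach-map proj₁ (inside-connected ya ya₁)) (reach-edge tt jx₁))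

  numComp-split : ∀ {a b} Y → NumComp G P k → lookup Y a ≡ true → lookup Y b ≡ false → Reach G P a b →
    ConnectedSides P Y → NumComp G (P ∖δ Y) (suc k)
  numComp-split {P = P} {k = k} {a = a} {b = b} Y (c , surj , same) ya yb a⟶b sides =
    c′ , surj′ , λ u v →
      mk⇔ (connect u v) (λ r → cong₂ label (reach-side Y proj₂ r) (from (same u v) (reach-map proj₁ r)))
    where
      open ConnectedSides sides
      label : Bool → Fin k → Fin (suc k)
      label true _ = fzero
      label false i = fsuc i
      c′ : Fin n → Fin (suc k)
      c′ v = label (lookup Y v) (c v)
      surj′ : ∀ i → ∃ λ v → c′ v ≡ i
      surj′ fzero = a , cong (λ β → label β (c a)) ya
      surj′ (fsuc i) with surj i
      ... | w , cw≡i with lookup Y w in yw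
      ...   | false = w , trans (cong (λ β → label β (c w)) yw) (cong fsuc cw≡i)
      ...   | true = b , trans (cong (λ β → label β (c b)) yb)
                       (cong fsuc (trans (from (same b w) b⟶w) cw≡i))
        where
          b⟶w : Reach G P b w
          b⟶w = reach-trans (reach-sym a⟶b) (reach-map proj₁ (inside-connected ya yw))
      connect : ∀ u v → c′ u ≡ c′ v → Reach G (P ∖δ Y) u v
      connect u v eq with lookup Y u in yu | lookup Y v in yv
      ... | true | true = inside-connected yu yv
      ... | false | false = outside-connected yu yv (to (same u v) (suc-injective eq))
      connect u v () | true | false
      connect u v () | false | true

  -- Separating bonds

  record Separation (P H : Fin m → Set) (a b : Fin n) : Set where
    field
      Y : Subset n
      a-outside : lookup Y a ≡ false
      b-inside : lookup Y b ≡ true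
      H-uncut : ∀ {x} → H x → x ∉ δ G Y
      sides : ConnectedSides P Y
      inside-reachable : ∀ {u} → lookup Y u ≡ true → Reach G P a u

  module _ {P H : Fin m → Set} {e : Fin m} {a b : Fin n} (P? : Decidable P) (H? : Decidable H)
           (H⊆P : ∀ {x} → H x → P x) (pe : P e) (je : Joins e a b) (¬a⟶b : ¬ Reach G H a b) where

    -- Y: the vertices reachable from b by P-edges that never touch Z, the H-component of a.
    private
      Z : Fin n → Set
      Z = Reach G H a

      Z? : Decidable Z
      Z? = reach? H? a

      Far : Fin m → Set
      Far = Within (¬_ ∘ Z) P

      Far? : Decidable Far
      Far? x = P? x ×-dec ¬? (Z? (src G x)) ×-dec ¬? (Z? (tgt G x))

      Y : Subset n
      Y = tabulate λ v → does (reach? Far? b v)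

      in-Y : Reach G Far b v → lookup Y v ≡ true
      in-Y {v} r = trans (lookup∘tabulate _ v) (dec-true (reach? Far? b v) r)

      in-Y⁻¹ : lookup Y v ≡ true → Reach G Far b v
      in-Y⁻¹ {v} yv with reach? Far? b v | trans (sym (lookup∘tabulate _ v)) yv
      ... | yes r | _ = r
      ... | no _ | ()

      Y⇒¬Z : lookup Y v ≡ true → ¬ Z v
      Y⇒¬Z yv = reach-within-end (in-Y⁻¹ yv) ¬a⟶b

      a⟶Y : lookup Y v ≡ true → Reach G P a v
      a⟶Y yv = reach-trans (reach-edge pe je) (reach-map proj₁ (in-Y⁻¹ yv))

      H-closed : H x → Joins x u v → lookup Y u ≡ true → lookup Y v ≡ true
      H-closed hx j yu = in-Y (step _ (in-Y⁻¹ yu) (H⊆P hx , joins-within ¬zu ¬zv j) j)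
        where
          ¬zu = Y⇒¬Z yu
          ¬zv = λ zv → ¬zu (reach-trans zv (reach-edge hx (joins-sym j)))

      H-uncut : H x → x ∉ δ G Y
      H-uncut {x} hx =
        ≡⇒∉δ Y (true-iff⇒≡ (H-closed hx (joins-ends x)) (H-closed hx (joins-sym (joins-ends x))))

      H-step : H x → (P ∖δ Y) x
      H-step hx = H⊆P hx , H-uncut hx

      far-step : ∀ {β} → Within (λ w → lookup Y w ≡ β) Far x → (P ∖δ Y) x
      far-step ((px , _) , ends) = within-side {P = P} Y (px , ends)

      inside-connected : lookup Y u ≡ true → lookup Y v ≡ true → Reach G (P ∖δ Y) u v
      inside-connected yu yv = reach-trans (reach-sym (from-b yu)) (from-b yv)
        where
          from-b : lookup Y w ≡ true → Reach G (P ∖δ Y) b w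
          from-b yw = reach-map far-step (reach-within in-Y (in-Y⁻¹ yw))

      -- A P-walk from w ∉ Y to a stays outside Y up to its first entry into Z; from there an
      -- H-walk leads to a.
      anchor : lookup Y w ≡ false → Reach G P w a → Reach G (P ∖δ Y) w a
      anchor {w} yw w⟶a with Z? w
      ... | yes zw = reach-map H-step (reach-sym zw)
      ... | no ¬zw with reach-exit (¬? ∘ Z?) w⟶a ¬zw (λ ¬za → ¬za here)
      ...   | a′ , b′ , x , px , jx , _ , ¬¬zb′ , w⟶a′ =
        reach-trans (reach-map far-step (reach-within never-in-Y w⟶a′))
          (reach-trans (reach-edge (px , ≡⇒∉δ Y (joins-invariant⁻¹ (lookup Y) jx (trans ya′ (sym yb′)))) jx)
            (reach-sym (reach-map H-step zb′)))
        where
          never-in-Y : Reach G Far w v → lookup Y v ≡ false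
          never-in-Y r = ¬-not λ yv →
            contradiction (trans (sym (in-Y (reach-trans (in-Y⁻¹ yv) (reach-sym r)))) yw) λ ()
          zb′ : Z b′
          zb′ = decidable-stable (Z? b′) ¬¬zb′
          ya′ : lookup Y a′ ≡ false
          ya′ = never-in-Y w⟶a′
          yb′ : lookup Y b′ ≡ false
          yb′ = ¬-not λ yb′ → Y⇒¬Z yb′ zb′

      outside-connected : lookup Y u ≡ false → lookup Y v ≡ false → Reach G P u v → Reach G (P ∖δ Y) u v
      outside-connected {u} yu yv u⟶v with reach? P? u a
      ... | yes u⟶a = reach-trans (anchor yu u⟶a) (reach-sym (anchor yv (reach-trans (reach-sym u⟶v) u⟶a)))
      ... | no ¬u⟶a = reach-map (within-side {P = P} Y) (reach-within away u⟶v)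
        where
          away : Reach G P u w → lookup Y w ≡ false
          away u⟶w = ¬-not λ yw → ¬u⟶a (reach-trans u⟶w (reach-sym (a⟶Y yw)))

    separation : Separation P H a b
    separation = record
      { Y = Y ; a-outside = ¬-not λ ya → Y⇒¬Z ya here ; b-inside = in-Y here ; H-uncut = H-uncut
      ; sides = record { inside-connected = inside-connected ; outside-connected = outside-connected }
      ; inside-reachable = a⟶Y }

  -- Modular pairs

  _+ₑ_ : (Fin m → Set) → Fin m → Fin m → Set
  (H +ₑ e) x = H x ⊎ x ≡ e

  +ₑ? : ∀ {H} → Decidable H → ∀ e → Decidable (H +ₑ e)
  +ₑ? H? e x = H? x ⊎-dec (x ≟ᶠ e)

  -- f is a second bridge, chosen so that the end a of e is H-connected to the end a′ of f or lies
  -- in another component of G; this is what keeps e out of the second bond below.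
  record Exchange (H : Fin m → Set) (e : Fin m) : Set where
    field
      a b a′ b′ : Fin n
      f : Fin m
      joins-e : Joins e a b
      joins-f : Joins f a′ b′
      ¬a⟶b : ¬ Reach G H a b
      ¬a′⟶b′ : ¬ Reach G (H +ₑ e) a′ b′
      a⟶a′ : Reach G H a a′ ⊎ ¬ Reach G (AllEdges G) a a′

  exchange : ∀ {H f} → Decidable H → ¬ Reach G H (src G e) (tgt G e) →
    ¬ Reach G (H +ₑ e) (src G f) (tgt G f) → Exchange H e
  exchange {e = e} {H = H} {f = f} H? ¬e ¬f = orient (choose-f (reach? all? (src G e) (src G f)))
    where
      Near : Fin n → Set
      Near = Reach G (H +ₑ e) (src G e)
      Candidate : Set
      Candidate = ∃ λ f′ → ∃₂ λ a′ b′ → Joins f′ a′ b′ × ¬ Reach G (H +ₑ e) a′ b′ ×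
        (Near a′ ⊎ ¬ Reach G (AllEdges G) (src G e) a′)
      choose-f : Dec (Reach G (AllEdges G) (src G e) (src G f)) → Candidate
      choose-f (no ¬r) = f , _ , _ , joins-ends f , ¬f , inj₂ ¬r
      choose-f (yes r) with reach? (+ₑ? H? e) (src G e) (src G f)
      ... | yes near = f , _ , _ , joins-ends f , ¬f , inj₁ near
      ... | no ¬near with reach-exit (reach? (+ₑ? H? e) (src G e)) r here ¬near
      ...   | a′ , b′ , f′ , _ , j , near , ¬near′ , _ =
        f′ , a′ , b′ , j , (λ r′ → ¬near′ (reach-trans near r′)) , inj₁ near
      orient : Candidate → Exchange H e
      orient (f′ , a′ , b′ , j , ¬r , inj₂ far) =
        record { joins-e = joins-ends e ; joins-f = j ; ¬a⟶b = ¬e ; ¬a′⟶b′ = ¬r ; a⟶a′ = inj₂ far }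
      orient (f′ , a′ , b′ , j , ¬r , inj₁ near) with reach-addEdge-from id near
      ... | inj₁ r = record { joins-e = joins-ends e ; joins-f = j ; ¬a⟶b = ¬e ; ¬a′⟶b′ = ¬r ; a⟶a′ = inj₁ r }
      ... | inj₂ (inj₁ r) =
        record { joins-e = joins-ends e ; joins-f = j ; ¬a⟶b = ¬e ; ¬a′⟶b′ = ¬r ; a⟶a′ = inj₁ r }
      ... | inj₂ (inj₂ r) = record { joins-e = joins-sym (joins-ends e) ; joins-f = j ; ¬a⟶b = ¬e ∘ reach-sym
                                   ; ¬a′⟶b′ = ¬r ; a⟶a′ = inj₁ r }

  -- δY₁ separates the ends of e avoiding H + f; inside G − δY₁, δY₂ separates the ends of f
  -- avoiding H. Each separation splits exactly one component, so δY₁ and δY₂ form a modular pair.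
  module _ {H : Fin m → Set} (H? : Decidable H) (ex : Exchange H e) where
    open Exchange ex

    private
      ¬a⟶b-with-f : ¬ Reach G (H +ₑ f) a b
      ¬a⟶b-with-f r with reach-addEdge id r
      ... | inj₁ a⟶b = ¬a⟶b a⟶b
      ... | inj₂ (c , d , j , a⟶c , d⟶b) = ¬a′⟶b′ (joins-reach j joins-f c⟶d)
        where
          lift : Reach G H u v → Reach G (H +ₑ e) u v
          lift = reach-map inj₁
          c⟶d : Reach G (H +ₑ e) c d
          c⟶d = reach-trans (reach-sym (lift a⟶c))
                  (reach-trans (reach-edge (inj₂ refl) joins-e) (reach-sym (lift d⟶b)))

      S₁ : Separation (AllEdges G) (H +ₑ f) a b
      S₁ = separation all? (+ₑ? H? f) _ tt joins-e ¬a⟶b-with-f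
      module S₁ = Separation S₁

      P₁ : Fin m → Set
      P₁ = AllEdges G ∖δ S₁.Y
      P₁? : Decidable P₁
      P₁? x = yes tt ×-dec ¬? (x ∈? δ G S₁.Y)

      S₂ : Separation P₁ H a′ b′
      S₂ = separation P₁? H? (λ hx → tt , S₁.H-uncut (inj₁ hx)) (tt , S₁.H-uncut (inj₂ refl)) joins-f
             (¬a′⟶b′ ∘ reach-map inj₁)
      module S₂ = Separation S₂

      same-side-P₁ : lookup S₁.Y u ≡ lookup S₁.Y v → Reach G (AllEdges G) u v → Reach G P₁ u v
      same-side-P₁ {u} eq r with lookup S₁.Y u in yu
      ... | true = ConnectedSides.inside-connected S₁.sides yu (sym eq)
      ... | false = ConnectedSides.outside-connected S₁.sides yu (sym eq) r

      forget : (P₁ ∖δ S₂.Y) x → (AllEdges G ∖δ S₂.Y) x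
      forget (_ , x∉) = tt , x∉

      H-step₂ : H x → (AllEdges G ∖δ S₂.Y) x
      H-step₂ hx = tt , S₂.H-uncut hx

      anchor : lookup S₂.Y w ≡ false → Reach G (AllEdges G) w a′ → Reach G (AllEdges G ∖δ S₂.Y) w a′
      anchor {w} y₂w w⟶a′ with lookup S₁.Y w ≟ᵇ lookup S₁.Y a′
      ... | yes same = reach-map forget
            (ConnectedSides.outside-connected S₂.sides y₂w S₂.a-outside (same-side-P₁ same w⟶a′))
      ... | no differ with a⟶a′
      ...   | inj₂ far = contradiction (trans (beyond w⟶a′) (sym (beyond here))) differ
        where
          beyond : Reach G (AllEdges G) v a′ → lookup S₁.Y v ≡ false
          beyond v⟶a′ = ¬-not λ y₁v → far (reach-trans (S₁.inside-reachable y₁v) v⟶a′)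
      ...   | inj₁ a⟶a′ = reach-trans w⟶b
                (reach-trans (reach-edge (tt , e∉δY₂) (joins-sym joins-e)) (reach-map H-step₂ a⟶a′))
        where
          y₁a′ : lookup S₁.Y a′ ≡ false
          y₁a′ = trans (sym (reach-side S₁.Y (S₁.H-uncut ∘ inj₁) a⟶a′)) S₁.a-outside
          y₁w : lookup S₁.Y w ≡ true
          y₁w = trans (¬-not differ) (cong not y₁a′)
          y₂a : lookup S₂.Y a ≡ false
          y₂a = trans (reach-side S₂.Y S₂.H-uncut a⟶a′) S₂.a-outside
          y₂b : lookup S₂.Y b ≡ false
          y₂b = ¬-not λ y₂b → contradiction
            (trans (sym y₁a′) (trans (reach-side S₁.Y proj₂ (S₂.inside-reachable y₂b)) S₁.b-inside)) λ ()
          e∉δY₂ : e ∉ δ G S₂.Y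
          e∉δY₂ = ≡⇒∉δ S₂.Y (joins-invariant⁻¹ (lookup S₂.Y) joins-e (trans y₂a (sym y₂b)))
          w⟶b : Reach G (AllEdges G ∖δ S₂.Y) w b
          w⟶b = reach-map forget (ConnectedSides.outside-connected S₂.sides y₂w y₂b
                  (same-side-P₁ (trans y₁w (sym S₁.b-inside))
                    (reach-trans w⟶a′ (reach-trans (reach-sym (reach-map _ a⟶a′)) (reach-edge tt joins-e)))))

      outside-connected₂ : lookup S₂.Y u ≡ false → lookup S₂.Y v ≡ false →
        Reach G (AllEdges G) u v → Reach G (AllEdges G ∖δ S₂.Y) u v
      outside-connected₂ {u} y₂u y₂v u⟶v with reach? all? u a′
      ... | yes u⟶a′ =
        reach-trans (anchor y₂u u⟶a′) (reach-sym (anchor y₂v (reach-trans (reach-sym u⟶v) u⟶a′)))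
      ... | no ¬u⟶a′ = reach-map (within-side S₂.Y) (reach-within away u⟶v)
        where
          away : Reach G (AllEdges G) u w → lookup S₂.Y w ≡ false
          away u⟶w = ¬-not λ y₂w →
            ¬u⟶a′ (reach-trans u⟶w (reach-sym (reach-map _ (S₂.inside-reachable y₂w))))

      sides₂ : ConnectedSides (AllEdges G) S₂.Y
      sides₂ = record
        { inside-connected = λ yu yv → reach-map forget (ConnectedSides.inside-connected S₂.sides yu yv)
        ; outside-connected = outside-connected₂ }

      comps : ∃ λ k → NumComp G (AllEdges G) k × NumComp G (P₁ ∖δ S₂.Y) (2 + k)
      comps with numComp all?
      ... | k , comps₀ = k , comps₀ ,
        numComp-split S₂.Y comps₁ S₂.b-inside S₂.a-outside (reach-edge f∈P₁ (joins-sym joins-f)) S₂.sides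
        where
          f∈P₁ : P₁ f
          f∈P₁ = tt , S₁.H-uncut (inj₂ refl)
          comps₁ : NumComp G P₁ (suc k)
          comps₁ =
            numComp-split S₁.Y comps₀ S₁.b-inside S₁.a-outside (reach-edge tt (joins-sym joins-e)) S₁.sides

      removed : (P₁ ∖δ S₂.Y) x → x ∉ δ G S₁.Y ∪ δ G S₂.Y
      removed ((_ , ∉₁) , ∉₂) x∈ = [ ∉₁ , ∉₂ ] (x∈p∪q⁻ _ _ x∈)

      unremoved : x ∉ δ G S₁.Y ∪ δ G S₂.Y → (P₁ ∖δ S₂.Y) x
      unremoved x∉ = (tt , x∉ ∘ x∈p∪q⁺ ∘ inj₁) , x∉ ∘ x∈p∪q⁺ ∘ inj₂

    modularPair-of-exchange : ∃₂ λ B₁ B₂ → ModularPair G B₁ B₂ × (∀ {x} → H x → x ∉ B₁ ∪ B₂)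
    modularPair-of-exchange with comps
    ... | k , comps₀ , comps₂ =
      δ G S₁.Y , δ G S₂.Y ,
      ( δ-isBond S₁.Y (joins-∈δ S₁.Y joins-e S₁.a-outside S₁.b-inside) S₁.sides
      , δ-isBond S₂.Y (joins-∈δ S₂.Y joins-f S₂.a-outside S₂.b-inside) sides₂
      , k , comps₀ , numComp-cong removed unremoved comps₂ ) ,
      λ hx → removed ((tt , S₁.H-uncut (inj₁ hx)) , S₂.H-uncut hx)

  modularPair-avoiding : ∀ {H f} → Decidable H → ¬ Reach G H (src G e) (tgt G e) →
    ¬ Reach G (H +ₑ e) (src G f) (tgt G f) → ∃₂ λ B₁ B₂ → ModularPair G B₁ B₂ × (∀ {x} → H x → x ∉ B₁ ∪ B₂)
  modularPair-avoiding H? ¬e ¬f = modularPair-of-exchange H? (exchange H? ¬e ¬f)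

  -- Forests

  Spanning : Subset m → Set
  Spanning F = ∀ x → Reach G (InSet G F) (src G x) (tgt G x)

  spanning-reach : ∀ {F} → Spanning F → Reach G P u v → Reach G (InSet G F) u v
  spanning-reach span here = here
  spanning-reach span (step x r _ j) =
    reach-trans (spanning-reach span r) (joins-reach (joins-ends x) j (span x))

  forest-∪-bridge : ∀ {F} → IsForest G F → ¬ Reach G (InSet G F) (src G e) (tgt G e) → IsForest G (F ∪ ⁅ e ⁆)
  forest-∪-bridge {e = e} {F = F} forest ¬e y y∈ r with x∈p∪q⁻ F _ y∈
  ... | inj₂ y∈⁅e⁆ rewrite x∈⁅y⁆⇒x≡y e y∈⁅e⁆ = ¬e (reach-map only-F r)
    where
      only-F : ∀ {z} → z ∈ (F ∪ ⁅ e ⁆) - e → z ∈ F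
      only-F z∈ with x∈p∪q⁻ F _ (p─q⊆p _ _ z∈)
      ... | inj₁ z∈F = z∈F
      ... | inj₂ z∈⁅e⁆ = contradiction (x∈⁅y⁆⇒x≡y e z∈⁅e⁆) (x∈p-y⇒x≢y z∈)
  ... | inj₁ y∈F with reach-addEdge split r
    where
      split : ∀ {z} → z ∈ (F ∪ ⁅ e ⁆) - y → z ∈ F - y ⊎ z ≡ e
      split z∈ with x∈p∪q⁻ F _ (p─q⊆p _ _ z∈)
      ... | inj₁ z∈F = inj₁ (x∈p∧x≢y⇒x∈p-y z∈F (x∈p-y⇒x≢y z∈))
      ... | inj₂ z∈⁅e⁆ = inj₂ (x∈⁅y⁆⇒x≡y e z∈⁅e⁆)
  ...   | inj₁ r′ = forest y y∈F r′
  ...   | inj₂ (c , d , j , y⟶c , d⟶y) = ¬e (joins-reach j (joins-ends e) c⟶d)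
    where
      to-F : Reach G (InSet G (F - y)) u v → Reach G (InSet G F) u v
      to-F = reach-map (p─q⊆p _ _)
      c⟶d : Reach G (InSet G F) c d
      c⟶d = reach-trans (reach-sym (to-F y⟶c))
              (reach-trans (reach-edge y∈F (joins-ends y)) (reach-sym (to-F d⟶y)))

  spanningForest-isMax : ∀ {F} → IsForest G F → Spanning F → IsMaxForest G F
  spanningForest-isMax {F} forest span =
    forest , λ F′ forest′ F⊆F′ {x} x∈F′ → by-cycle F′ forest′ F⊆F′ x∈F′ (x ∈? F)
    where
      by-cycle : ∀ F′ → IsForest G F′ → F ⊆ F′ → x ∈ F′ → Dec (x ∈ F) → x ∈ F
      by-cycle F′ forest′ F⊆F′ x∈F′ (yes x∈F) = x∈F
      by-cycle F′ forest′ F⊆F′ x∈F′ (no x∉F) =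
        contradiction (reach-map (λ y∈F → x∈p∧x≢y⇒x∈p-y (F⊆F′ y∈F) λ { refl → x∉F y∈F }) (span _))
          (forest′ _ x∈F′)

  maxForest-spanning : ∀ {F} → IsMaxForest G F → Spanning F
  maxForest-spanning {F} (forest , maximal) x with reach? (_∈? F) (src G x) (tgt G x)
  ... | yes r = r
  ... | no ¬r =
    reach-edge (maximal _ (forest-∪-bridge forest ¬r) (p⊆p∪q _) (q⊆p∪q F _ (x∈⁅x⁆ x))) (joins-ends x)

  bond-avoiding : ∀ {F} → ¬ Reach G (InSet G F) (src G x) (tgt G x) →
    ∃ λ Y → IsBond G (δ G Y) × x ∈ δ G Y × (∀ {y} → y ∈ F → y ∉ δ G Y)
  bond-avoiding {x} {F} ¬r = Y , δ-isBond Y x∈δY sides , x∈δY , H-uncut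
    where
      open Separation (separation all? (_∈? F) _ tt (joins-ends x) ¬r)
      x∈δY = joins-∈δ Y (joins-ends x) a-outside b-inside

  module _ {T : Subset m} (T-max : IsMaxForest G T) (e∈T : e ∈ T) where

    private
      F : Subset m
      F = T - e

      _⟶ᶠ_ : Fin n → Fin n → Set
      u ⟶ᶠ v = Reach G (InSet G F) u v

      ¬e : ¬ src G e ⟶ᶠ tgt G e
      ¬e = proj₁ T-max e e∈T

      open Separation (separation all? (_∈? F) _ tt (joins-ends e) ¬e)

      classes-of-edge : Reach G (AllEdges G) u v → ¬ u ⟶ᶠ v → src G e ⟶ᶠ v ⊎ tgt G e ⟶ᶠ v
      classes-of-edge r ¬r with reach-addEdge-from split (spanning-reach (maxForest-spanning T-max) r)
        where
          split : ∀ {y} → y ∈ T → y ∈ F ⊎ y ≡ e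
          split {y} y∈T with y ≟ᶠ e
          ... | yes y≡e = inj₂ y≡e
          ... | no y≢e = inj₁ (x∈p∧x≢y⇒x∈p-y y∈T y≢e)
      ... | inj₁ r′ = contradiction r′ ¬r
      ... | inj₂ by-end = by-end

      src-side : src G e ⟶ᶠ u → lookup Y u ≡ false
      src-side r = trans (sym (reach-side Y H-uncut r)) a-outside

      tgt-side : tgt G e ⟶ᶠ u → lookup Y u ≡ true
      tgt-side r = trans (sym (reach-side Y H-uncut r)) b-inside

      same-side⇒⟶ᶠ : lookup Y u ≡ lookup Y v →
        src G e ⟶ᶠ u ⊎ tgt G e ⟶ᶠ u → src G e ⟶ᶠ v ⊎ tgt G e ⟶ᶠ v → u ⟶ᶠ v
      same-side⇒⟶ᶠ _ (inj₁ ru) (inj₁ rv) = reach-trans (reach-sym ru) rv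
      same-side⇒⟶ᶠ _ (inj₂ ru) (inj₂ rv) = reach-trans (reach-sym ru) rv
      same-side⇒⟶ᶠ eq (inj₁ ru) (inj₂ rv) =
        contradiction (trans (sym (src-side ru)) (trans eq (tgt-side rv))) λ ()
      same-side⇒⟶ᶠ eq (inj₂ ru) (inj₁ rv) =
        contradiction (trans (sym (src-side rv)) (trans (sym eq) (tgt-side ru))) λ ()

      ⟶ᶠ⇔same-side : Reach G (AllEdges G) u v → u ⟶ᶠ v ⇔ lookup Y u ≡ lookup Y v
      ⟶ᶠ⇔same-side {u} {v} r = mk⇔ (reach-side Y H-uncut) λ eq → decidable-stable (reach? (_∈? F) u v) λ ¬r →
        ¬r (same-side⇒⟶ᶠ eq (classes-of-edge (reach-sym r) (¬r ∘ reach-sym)) (classes-of-edge r ¬r))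

      F-avoids : ∀ {D} → D ⊆ ∁ F → x ∈ F → x ∉ D
      F-avoids D⊆∁F x∈F x∈D = x∈∁p⇒x∉p (D⊆∁F x∈D) x∈F

      edge : ∀ y → Reach G (AllEdges G) (src G y) (tgt G y)
      edge y = reach-edge tt (joins-ends y)

    ext-bond : ∀ {S} → (∀ y → y ∈ S ⇔ InExt G (T - e) y) → IsBond G S
    ext-bond {S} S⇔ext =
      subst (IsBond G) (⊆-antisym δY⊆S S⊆δY) (δ-isBond Y (joins-∈δ Y (joins-ends e) a-outside b-inside) sides)
      where
        δY⊆S : δ G Y ⊆ S
        δY⊆S {y} y∈ = from (S⇔ext y) λ r → ∈δ⇒≢ Y y∈ (to (⟶ᶠ⇔same-side (edge y)) r)
        S⊆δY : S ⊆ δ G Y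
        S⊆δY {y} y∈ = ≢⇒∈δ Y λ eq → to (S⇔ext y) y∈ (from (⟶ᶠ⇔same-side (edge y)) eq)

    bond-avoiding-unique : ∀ {S B} → (∀ y → y ∈ S ⇔ InExt G (T - e) y) → IsBond G B → B ⊆ ∁ (T - e) → B ≡ S
    bond-avoiding-unique S⇔ext ((X , refl) , nonempty , _) δX⊆∁F =
      proj₂ (proj₂ (ext-bond S⇔ext)) _ (X , refl) nonempty
        λ {y} y∈ → from (S⇔ext y) λ r → ∈δ⇒≢ X y∈ (reach-side X (F-avoids δX⊆∁F) r)

    tribond-meets : ∀ {X₁ X₂ X₃} → Tripartition G X₁ X₂ X₃ → ¬ (δ G X₁ ∪ δ G X₂ ∪ δ G X₃ ⊆ ∁ (T - e))
    tribond-meets {X₁} {X₂} {X₃}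
      ((_ , component) , (∅₁₂ , ∅₁₃ , ∅₂₃) , ((x₁ , x₁∈) , (x₂ , x₂∈) , (x₃ , x₃∈)) , _) ⊆∁F =
      three-distinct-bools (apart δ₁ ∅₁₂ x₁∈ x₂∈ (joined x₁∈₁ x₂∈₂)) (apart δ₁ ∅₁₃ x₁∈ x₃∈ (joined x₁∈₁ x₃∈₃))
        (apart δ₂ ∅₂₃ x₂∈ x₃∈ (joined x₂∈₂ x₃∈₃))
      where
        x₁∈₁ = x∈p∪q⁺ (inj₁ x₁∈)
        x₂∈₂ = x∈p∪q⁺ (inj₂ (x∈p∪q⁺ (inj₁ x₂∈)))
        x₃∈₃ = x∈p∪q⁺ (inj₂ (x∈p∪q⁺ (inj₂ x₃∈)))
        δ₁ : δ G X₁ ⊆ ∁ F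
        δ₁ = ⊆∁F ∘ x∈p∪q⁺ ∘ inj₁
        δ₂ : δ G X₂ ⊆ ∁ F
        δ₂ = ⊆∁F ∘ x∈p∪q⁺ ∘ inj₂ ∘ x∈p∪q⁺ ∘ inj₁
        joined : ∀ {w w′} → w ∈ X₁ ∪ X₂ ∪ X₃ → w′ ∈ X₁ ∪ X₂ ∪ X₃ → Reach G (AllEdges G) w w′
        joined w∈ w′∈ = reach-trans (reach-sym (to (component _) w∈)) (to (component _) w′∈)
        apart : ∀ {Xᵢ Xⱼ w w′} → δ G Xᵢ ⊆ ∁ F → Empty (Xᵢ ∩ Xⱼ) → w ∈ Xᵢ → w′ ∈ Xⱼ →
          Reach G (AllEdges G) w w′ → lookup Y w ≢ lookup Y w′
        apart {Xᵢ} δ⊆ disjoint w∈ w′∈ r eq =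
          disjoint (_ , x∈p∩q⁺ (reach-∈ Xᵢ (F-avoids δ⊆) (from (⟶ᶠ⇔same-side r) eq) w∈ , w′∈))

    -- G − (B₁ ∪ B₂) keeps F, whose classes are those of G with the component of e split in two, so
    -- it has at most k + 1 components.
    modularPair-meets : ∀ {B₁ B₂} → ModularPair G B₁ B₂ → ¬ (B₁ ∪ B₂ ⊆ ∁ (T - e))
    modularPair-meets (_ , _ , k , (c , surj , same) , comps₂) ⊆∁F =
      ≤⇒≯ (numComp-bound comps₂ r covered) (n<1+n (suc k))
      where
        section : ∀ ℓ → ∃ λ v → c v ≡ ℓ × (ℓ ≡ c (src G e) → v ≡ src G e)
        section ℓ with ℓ ≟ᶠ c (src G e)
        ... | yes refl = src G e , refl , λ _ → refl
        ... | no ℓ≢ = proj₁ (surj ℓ) , proj₂ (surj ℓ) , λ ℓ≡ → contradiction ℓ≡ ℓ≢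
        r : Fin (suc k) → Fin n
        r fzero = tgt G e
        r (fsuc ℓ) = proj₁ (section ℓ)
        lift : u ⟶ᶠ v → Reach G (λ x → x ∉ _ ∪ _) u v
        lift = reach-map (F-avoids ⊆∁F)
        covered : ∀ v → ∃ λ i → Reach G (λ x → x ∉ _ ∪ _) (r i) v
        covered v with reach? (_∈? F) (r (fsuc (c v))) v
        ... | yes r⟶v = fsuc (c v) , lift r⟶v
        ... | no ¬r⟶v with classes-of-edge (to (same _ v) (proj₁ (proj₂ (section (c v))))) ¬r⟶v
        ...   | inj₁ e⟶v =
          fsuc (c (src G e)) , lift (subst (_⟶ᶠ v) (sym (proj₂ (proj₂ (section _)) refl)) e⟶v)
        ...   | inj₂ e⟶v = fzero , lift e⟶v

    modularPair-of-edge : x ∈ T - e → ∃₂ λ B₁ B₂ → ModularPair G B₁ B₂ × (∀ {y} → y ∈ T - e - x → y ∉ B₁ ∪ B₂)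
    modularPair-of-edge {x} x∈F = modularPair-avoiding (_∈? (F - x)) (¬e ∘ reach-map (p─q⊆p _ _))
      λ r → proj₁ T-max x (p─q⊆p _ _ x∈F) (reach-map into-T-x r)
      where
        into-T-x : ∀ {y} → y ∈ F - x ⊎ y ≡ e → y ∈ T - x
        into-T-x (inj₁ y∈) = x∈p∧x≢y⇒x∈p-y (p─q⊆p _ _ (p─q⊆p _ _ y∈)) (x∈p-y⇒x≢y y∈)
        into-T-x (inj₂ refl) = x∈p∧x≢y⇒x∈p-y e∈T λ { refl → x∈p-y⇒x≢y x∈F refl }

  Ext : Subset m → Subset m
  Ext F = tabulate λ y → not (does (reach? (_∈? F) (src G y) (tgt G y)))

  ∈Ext⇔ : ∀ F y → y ∈ Ext F ⇔ InExt G F y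
  ∈Ext⇔ F y = mk⇔
    (λ y∈ r → contradiction
      (trans (sym ([]=⇒lookup y∈)) (trans (lookup∘tabulate _ y) (cong not (dec-true (reach? _ _ _) r)))) λ ())
    (λ ¬r → lookup⇒[]= y (Ext F) (trans (lookup∘tabulate _ y) (cong not (dec-false (reach? _ _ _) ¬r))))

  ext⊆∁ : ∀ {S F} → (∀ y → y ∈ S ⇔ InExt G F y) → S ⊆ ∁ F
  ext⊆∁ S⇔ext {y} y∈ = x∉p⇒x∈∁p λ y∈F → to (S⇔ext y) y∈ (reach-edge y∈F (joins-ends y))

  avoiding⇒⊆∁ : ∀ {H D : Subset m} → (∀ {y} → y ∈ H → y ∉ D) → D ⊆ ∁ H
  avoiding⇒⊆∁ avoids y∈D = x∉p⇒x∈∁p λ y∈H → avoids y∈H y∈D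

  avoiding-minus⇒⊆ : ∀ {H D J : Subset m} → (∀ {y} → y ∈ H - x → y ∉ D) → x ∈ J → ∁ H ⊆ J → D ⊆ J
  avoiding-minus⇒⊆ {x} avoids x∈J ∁H⊆J {y} y∈D with y ≟ᶠ x
  ... | yes refl = x∈J
  ... | no y≢x = ∁H⊆J (x∉p⇒x∈∁p λ y∈H → avoids (x∈p∧x≢y⇒x∈p-y y∈H y≢x) y∈D)

  -- Bases of J₀

  cocircuit-cuts : ∀ {L C} → J0Cocircuit G L C → ∃₂ λ β C′ → C ≡ β ∷ C′ × UnionOfCuts C′ × Nonempty C′
  cocircuit-cuts (lbond B bond _) = outside , B , refl , bond-cuts bond , proj₁ (proj₂ bond)
  cocircuit-cuts (nlbond B bond _) = inside , B , refl , bond-cuts bond , proj₁ (proj₂ bond)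
  cocircuit-cuts (tri _ (X₁ , X₂ , X₃ , (_ , (∅₁₂ , _) , _ , _ , (joined₁₂ , _)) , refl) _) =
    outside , _ , refl , ∪-cuts (δ-cuts X₁) (∪-cuts (δ-cuts X₂) (δ-cuts X₃)) ,
    let (x , x∈) = joined-δ ∅₁₂ joined₁₂ in x , x∈p∪q⁺ (inj₁ x∈)
  cocircuit-cuts (di _ (B₁ , B₂ , (bond₁ , bond₂ , _) , refl , _) _) =
    outside , _ , refl , ∪-cuts (bond-cuts bond₁) (bond-cuts bond₂) ,
    let (x , x∈) = proj₁ (proj₂ bond₁) in x , x∈p∪q⁺ (inj₁ x∈)

  module _ (L : Subset m → Bool) (L-bond : ∀ S → L S ≡ true → IsBond G S) where

    private
      variable
        β : Bool
        H J : Subset m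

      CoIndep₀ : Subset (suc m) → Set
      CoIndep₀ = CoIndep (J0Cocircuit G L)

    lBond-⊈ : ∀ {B} → CoIndep₀ (β ∷ J) → L B ≡ true → ¬ B ⊆ J
    lBond-⊈ coind LB B⊆J = coind _ (lbond _ (L-bond _ LB) LB) (out⊆ B⊆J)

    bond-⊈ : ∀ {B} → CoIndep₀ (inside ∷ J) → IsBond G B → ¬ B ⊆ J
    bond-⊈ {B = B} coind bond B⊆J with L B in LB
    ... | true = lBond-⊈ coind LB B⊆J
    ... | false = coind _ (nlbond _ bond LB) (s⊆s B⊆J)

    modularPair-⊈ : ∀ {B₁ B₂} → CoIndep₀ (β ∷ J) → ModularPair G B₁ B₂ → ¬ B₁ ∪ B₂ ⊆ J
    modularPair-⊈ {B₁ = B₁} {B₂} coind mp ⊆J =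
      coind _ (di _ (B₁ , B₂ , mp , refl , not-tribond) no-lBond) (out⊆ ⊆J)
      where
        no-lBond : ContainsNoLBond G L (B₁ ∪ B₂)
        no-lBond B LB B⊆ = lBond-⊈ coind LB (⊆J ∘ B⊆)
        not-tribond : ¬ IsTribond G (B₁ ∪ B₂)
        not-tribond tribond = coind _ (tri _ tribond no-lBond) (out⊆ ⊆J)

    spanning-coIndep : Spanning H → CoIndep₀ (β ∷ ∁ H)
    spanning-coIndep span C cocircuit C⊆ with cocircuit-cuts cocircuit
    ... | _ , C′ , refl , cuts , (x , x∈) with cuts-meet-walks cuts x∈ (span x)
    ...   | y , y∈H , y∈C′ = x∈∁p⇒x∉p (drop-∷-⊆ C⊆ y∈C′) y∈H

    basis-forest : IsBasis (J0Cocircuit G L) (β ∷ H) → IsForest G H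
    basis-forest {β} {H} (coind , maximal) x x∈H cycle =
      x∈∁p⇒x∉p (drop-there (maximal _ coind-x (s⊆s ∁H⊆∁H-x) (there x∈∁H-x))) x∈H
      where
        ∁H⊆∁H-x : ∁ H ⊆ ∁ (H - x)
        ∁H⊆∁H-x y∈ = x∉p⇒x∈∁p (x∈∁p⇒x∉p y∈ ∘ p─q⊆p _ _)
        x∈∁H-x : x ∈ ∁ (H - x)
        x∈∁H-x = x∉p⇒x∈∁p λ x∈ → x∈p-y⇒x≢y x∈ refl
        coind-x : CoIndep₀ (not β ∷ ∁ (H - x))
        coind-x C cocircuit C⊆ with cocircuit-cuts cocircuit
        ... | γ , C′ , refl , cuts , _ = coind _ cocircuit C⊆∁H
          where
            C′⊆∁H : C′ ⊆ ∁ H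
            C′⊆∁H {y} y∈ with y ≟ᶠ x
            ... | yes refl = let (z , z∈ , z∈C′) = cuts-meet-walks cuts y∈ cycle in
                             contradiction z∈ (x∈∁p⇒x∉p (drop-∷-⊆ C⊆ z∈C′))
            ... | no y≢x = x∉p⇒x∈∁p λ y∈H → x∈∁p⇒x∉p (drop-∷-⊆ C⊆ y∈) (x∈p∧x≢y⇒x∈p-y y∈H y≢x)
            C⊆∁H : γ ∷ C′ ⊆ not β ∷ ∁ H
            C⊆∁H = ∷-⊆-∷ C⊆ C′⊆∁H

    basis-without-e₀ : IsBasis (J0Cocircuit G L) (outside ∷ H) → IsMaxForest G H
    basis-without-e₀ {H} basis@(coind , _) = spanningForest-isMax (basis-forest basis) span
      where
        span : Spanning H
        span x = decidable-stable (reach? (_∈? H) _ _) λ ¬r →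
          let (_ , bond , _ , avoids) = bond-avoiding ¬r in bond-⊈ coind bond (avoiding⇒⊆∁ avoids)

    basis-bridge : IsBasis (J0Cocircuit G L) (inside ∷ H) → ∃ λ e → ¬ Reach G (InSet G H) (src G e) (tgt G e)
    basis-bridge {H} (_ , maximal) = ¬∀⟶∃¬ m _ (λ x → reach? (_∈? H) _ _) ¬spanning
      where
        ¬spanning : ¬ Spanning H
        ¬spanning span with maximal _ (spanning-coIndep span) (out⊆ id) here
        ... | ()

    basis-with-e₀ : IsBasis (J0Cocircuit G L) (inside ∷ H) →
      (∃ λ T → IsMaxForest G T × ∃ λ e → e ∈ T × H ≡ T - e) ×
      (∃ λ S → (∀ e → (e ∈ S ⇔ InExt G H e)) × L S ≡ false)
    basis-with-e₀ {H} basis@(coind , _) with basis-bridge basis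
    ... | e , ¬e =
      (H ∪ ⁅ e ⁆ , T-max , e , q⊆p∪q H _ (x∈⁅x⁆ e) , H≡T-e) ,
      Ext H , ∈Ext⇔ H , ¬-not λ LExt → lBond-⊈ coind LExt (ext⊆∁ (∈Ext⇔ H))
      where
        into-T : ∀ {y} → y ∈ H ⊎ y ≡ e → y ∈ H ∪ ⁅ e ⁆
        into-T (inj₁ y∈H) = p⊆p∪q _ y∈H
        into-T (inj₂ refl) = q⊆p∪q H _ (x∈⁅x⁆ _)
        T-span : Spanning (H ∪ ⁅ e ⁆)
        T-span f = decidable-stable (reach? (_∈? (H ∪ ⁅ e ⁆)) _ _) λ ¬f →
          let (_ , _ , mp , avoids) = modularPair-avoiding (_∈? H) ¬e (¬f ∘ reach-map into-T) in
          modularPair-⊈ coind mp (avoiding⇒⊆∁ avoids)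
        T-max : IsMaxForest G (H ∪ ⁅ e ⁆)
        T-max = spanningForest-isMax (forest-∪-bridge (basis-forest basis) ¬e) T-span
        H≡T-e : H ≡ (H ∪ ⁅ e ⁆) - e
        H≡T-e = ⊆-antisym
          (λ y∈H → x∈p∧x≢y⇒x∈p-y (p⊆p∪q _ y∈H) λ { refl → ¬e (reach-edge y∈H (joins-ends _)) }) T-e⊆H
          where
            T-e⊆H : (H ∪ ⁅ e ⁆) - e ⊆ H
            T-e⊆H y∈ with x∈p∪q⁻ H _ (p─q⊆p _ _ y∈)
            ... | inj₁ y∈H = y∈H
            ... | inj₂ y∈⁅e⁆ = contradiction (x∈⁅y⁆⇒x≡y e y∈⁅e⁆) (x∈p-y⇒x≢y y∈)

    maxForest-basis : IsMaxForest G H → IsBasis (J0Cocircuit G L) (outside ∷ H)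
    maxForest-basis {H} H-max = spanning-coIndep (maxForest-spanning H-max) , maximal
      where
        maximal : ∀ I → CoIndep₀ I → inside ∷ ∁ H ⊆ I → I ⊆ inside ∷ ∁ H
        maximal (false ∷ _) _ ⊆I with ⊆I here
        ... | ()
        maximal (true ∷ J) coind ⊆I here = here
        maximal (true ∷ J) coind ⊆I (there x∈J) = there (x∉p⇒x∈∁p λ x∈H →
          let (_ , bond , _ , avoids) = bond-avoiding (proj₁ H-max _ x∈H) in
          bond-⊈ coind bond (avoiding-minus⇒⊆ avoids x∈J (drop-∷-⊆ ⊆I)))

    forestMinusEdge-basis : ∀ {T e S} → IsMaxForest G T → e ∈ T → (∀ y → y ∈ S ⇔ InExt G (T - e) y) →
      L S ≡ false → IsBasis (J0Cocircuit G L) (inside ∷ (T - e))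
    forestMinusEdge-basis {T} {e} {S} T-max e∈T S⇔ext LS = coind , maximal
      where
        coind : CoIndep₀ (outside ∷ ∁ (T - e))
        coind _ (lbond B bond LB) ⊆∁F =
          contradiction (trans (sym LB) (trans (cong L B≡S) LS)) λ ()
          where
            B≡S = bond-avoiding-unique T-max e∈T S⇔ext bond (drop-∷-⊆ ⊆∁F)
        coind _ (nlbond _ _ _) ⊆∁F with ⊆∁F here
        ... | ()
        coind _ (tri _ (_ , _ , _ , tp , refl) _) ⊆∁F = tribond-meets T-max e∈T tp (drop-∷-⊆ ⊆∁F)
        coind _ (di _ (_ , _ , mp , refl , _) _) ⊆∁F = modularPair-meets T-max e∈T mp (drop-∷-⊆ ⊆∁F)
        maximal : ∀ I → CoIndep₀ I → outside ∷ ∁ (T - e) ⊆ I → I ⊆ outside ∷ ∁ (T - e)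
        maximal (true ∷ J) coind′ ⊆I =
          ⊥-elim (coind′ _ (nlbond S (ext-bond T-max e∈T S⇔ext) LS) (s⊆s (drop-∷-⊆ ⊆I ∘ ext⊆∁ S⇔ext)))
        maximal (false ∷ J) coind′ ⊆I (there x∈J) = there (x∉p⇒x∈∁p λ x∈F →
          let (_ , _ , mp , avoids) = modularPair-of-edge T-max e∈T x∈F in
          modularPair-⊈ coind′ mp (avoiding-minus⇒⊆ avoids x∈J (drop-∷-⊆ ⊆I)))

theorem3p3 : ∀ {n m : ℕ} (G : Graph n m) (L : Subset m → Bool) →
    LinearClass G L → NonTrivial G L →
    ∀ (B : Subset (suc m)) →
    IsBasis (J0Cocircuit G L) B ⇔
      ((∃ λ T → IsMaxForest G T × B ≡ outside ∷ T) ⊎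
       (∃ λ F → B ≡ inside ∷ F ×
          (∃ λ T → IsMaxForest G T × ∃ λ e → e ∈ T × F ≡ T - e) ×
          (∃ λ S → (∀ e → (e ∈ S ⇔ InExt G F e)) × L S ≡ false)))
theorem3p3 G L (L-bond , _) _ (false ∷ H) =
  mk⇔ (λ basis → inj₁ (H , basis-without-e₀ G L L-bond basis , refl))
      λ { (inj₁ (_ , T-max , refl)) → maxForest-basis G L L-bond T-max
        ; (inj₂ (_ , () , _)) }
theorem3p3 G L (L-bond , _) _ (true ∷ H) =
  mk⇔ (λ basis → inj₂ (H , refl , basis-with-e₀ G L L-bond basis))
      λ { (inj₁ (_ , _ , ()))
        ; (inj₂ (_ , refl , (_ , T-max , _ , e∈T , refl) , _ , S⇔ext , LS)) →
            forestMinusEdge-basis G L L-bond T-max e∈T S⇔ext LS }
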